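{- Let $G_v$ and $H_w$ be rooted graphs, each on at least two vertices, with $I(G_v;-1)=[a-b,a,b]$ and $I(H_w;-1)=[c-d,c,d]$. Then $I(G_v\wedge H_w;-1)=ac-bd$, and the rooted graph $G_v\wedge H_w$ has bracket $[ac-bd,ac,bd]$.
   Context: All graphs are finite and simple. The independence polynomial of $G$ is $I(G;x)=\sum_{j\ge 0} s_j x^j$, where $s_j$ is the number of independent sets of size $j$ in $G$ (with $s_0=1$). A rooted graph $G_v$ is a graph $G$ with a distinguished vertex $v$ (the root); $I(G_v;-1)$ means $I(G;-1)$. For a vertex $v$, $N[v]$ denotes $v$ together with its neighbours. Bracket notation: writing $I(G_v;-1)=[a-b,a,b]$ (equivalently, "$G_v$ has bracket $[a-b,a,b]$") means $I(G-v;-1)=a$ and $I(G-N[v];-1)=b$ (whence $I(G;-1)=a-b$). The pasting $G_v\wedge H_w$ of two vertex-disjoint rooted graphs is the rooted graph obtained by identifying the roots $v$ and $w$, the identified vertex being the new root. -}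

module Defs where

open import Data.Bool using (Bool; true; false; _∧_; not; if_then_else_)
open import Data.Nat using (ℕ; zero; suc; _+_; _≡ᵇ_)
open import Data.Fin using (Fin; zero; suc; punchIn; splitAt)
open import Data.Sum using (inj₁; inj₂)
open import Data.List using (List; []; _∷_; [_]; map; _++_; length; filterᵇ; allFin; lookup; upTo; foldr)
open import Data.Vec using (Vec; []; _∷_; countᵇ)
import Data.Vec as Vec
open import Data.Integer using (ℤ; +_; _^_)
import Data.Integer as ℤ
open import Relation.Binary.PropositionalEquality using (_≡_; refl)
open import Data.Product using (_×_)

record Graph (n : ℕ) : Set where
  field
    adj    : Fin n → Fin n → Bool
    sym    : ∀ i j → adj i j ≡ adj j i
    irrefl : ∀ i → adj i i ≡ false
open Graph public

keep : ∀ {n} → (Fin n → Bool) → List (Fin n)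
keep {n} p = filterᵇ p (allFin n)

induced : ∀ {n} → Graph n → (p : Fin n → Bool) → Graph (length (keep p))
induced G p = record
  { adj    = λ i j → adj G (lookup (keep p) i) (lookup (keep p) j)
  ; sym    = λ i j → sym G (lookup (keep p) i) (lookup (keep p) j)
  ; irrefl = λ i → irrefl G (lookup (keep p) i)
  }

eqFin : ∀ {n} → Fin n → Fin n → Bool
eqFin zero    zero    = true
eqFin zero    (suc _) = false
eqFin (suc _) zero    = false
eqFin (suc i) (suc j) = eqFin i j

minusV : ∀ {n} → Fin n → Fin n → Bool
minusV v u = not (eqFin u v)

deleteVertex : ∀ {n} (G : Graph n) (v : Fin n) → Graph (length (keep (minusV v)))
deleteVertex G v = induced G (minusV v)

minusN : ∀ {n} → Graph n → Fin n → Fin n → Bool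
minusN G v u = not (eqFin u v) ∧ not (adj G v u)

deleteClosedNbhd : ∀ {n} (G : Graph n) (v : Fin n) → Graph (length (keep (minusN G v)))
deleteClosedNbhd G v = induced G (minusN G v)

allSubsets : ∀ n → List (Vec Bool n)
allSubsets zero    = [ [] ]
allSubsets (suc n) = map (true ∷_) (allSubsets n) ++ map (false ∷_) (allSubsets n)

allB : ∀ {A : Set} → (A → Bool) → List A → Bool
allB p = foldr (λ x r → p x ∧ r) true

isIndependent : ∀ {n} → Graph n → Vec Bool n → Bool
isIndependent {n} G S =
  allB (λ i → allB (λ j → not (Vec.lookup S i ∧ Vec.lookup S j ∧ adj G i j)) (allFin n)) (allFin n)

size : ∀ {n} → Vec Bool n → ℕ
size S = countᵇ (λ b → b) S

indepCount : ∀ {n} → Graph n → ℕ → ℕ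
indepCount {n} G j = length (filterᵇ (λ S → isIndependent G S ∧ (size S ≡ᵇ j)) (allSubsets n))

sumℤ : List ℤ → ℤ
sumℤ = foldr ℤ._+_ (+ 0)

indPoly : ∀ {n} → Graph n → ℤ → ℤ
indPoly {n} G x = sumℤ (map (λ j → (+ indepCount G j) ℤ.* (x ^ j)) (upTo (suc n)))

I₋₁ : ∀ {n} → Graph n → ℤ
I₋₁ G = indPoly G (ℤ.- (+ 1))

HasBracket : ∀ {n} → Graph n → Fin n → ℤ → ℤ → ℤ → Set
HasBracket G v t a b =
  I₋₁ G ≡ t × I₋₁ (deleteVertex G v) ≡ a × I₋₁ (deleteClosedNbhd G v) ≡ b

-- The pasted graph has vertex set Fin (suc (m + k)): vertex 0 is the
-- identified root, vertex suc i with splitAt m i = inj₁ j is the vertex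
-- punchIn v j of G, and with inj₂ j it is the vertex punchIn w j of H.

data PV (m k : ℕ) : Set where
  pRoot : PV m k
  pG    : Fin m → PV m k
  pH    : Fin k → PV m k

classify : ∀ {m k} → Fin (suc (m + k)) → PV m k
classify zero = pRoot
classify {m} (suc i) with splitAt m i
... | inj₁ j = pG j
... | inj₂ j = pH j

module _ {m k : ℕ} (G : Graph (suc m)) (v : Fin (suc m))
                   (H : Graph (suc k)) (w : Fin (suc k)) where

  adjPV : PV m k → PV m k → Bool
  adjPV pRoot  pRoot  = false
  adjPV pRoot  (pG j) = adj G v (punchIn v j)
  adjPV pRoot  (pH j) = adj H w (punchIn w j)
  adjPV (pG i) pRoot  = adj G (punchIn v i) v
  adjPV (pG i) (pG j) = adj G (punchIn v i) (punchIn v j)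
  adjPV (pG i) (pH j) = false
  adjPV (pH i) pRoot  = adj H (punchIn w i) w
  adjPV (pH i) (pG j) = false
  adjPV (pH i) (pH j) = adj H (punchIn w i) (punchIn w j)

  adjPV-sym : ∀ x y → adjPV x y ≡ adjPV y x
  adjPV-sym pRoot  pRoot  = refl
  adjPV-sym pRoot  (pG j) = sym G v (punchIn v j)
  adjPV-sym pRoot  (pH j) = sym H w (punchIn w j)
  adjPV-sym (pG i) pRoot  = sym G (punchIn v i) v
  adjPV-sym (pG i) (pG j) = sym G (punchIn v i) (punchIn v j)
  adjPV-sym (pG i) (pH j) = refl
  adjPV-sym (pH i) pRoot  = sym H (punchIn w i) w
  adjPV-sym (pH i) (pG j) = refl
  adjPV-sym (pH i) (pH j) = sym H (punchIn w i) (punchIn w j)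

  adjPV-irrefl : ∀ x → adjPV x x ≡ false
  adjPV-irrefl pRoot  = refl
  adjPV-irrefl (pG i) = irrefl G (punchIn v i)
  adjPV-irrefl (pH i) = irrefl H (punchIn w i)

  paste : Graph (suc (m + k))
  paste = record
    { adj    = λ i j → adjPV (classify i) (classify j)
    ; sym    = λ i j → adjPV-sym (classify i) (classify j)
    ; irrefl = λ i → adjPV-irrefl (classify i)
    }

pasteRoot : ∀ {m k} → Fin (suc (m + k))
pasteRoot = zero

-- I(G;-1) is the signed count Σ (-1)^|T| of the independent sets T of G, and it makes sense for the
-- independent sets inside any vertex list L.  Splitting on whether the first vertex x of L is used gives
-- the deletion recurrence I(L) = I(L - x) - I(L - N[x]), and iterating it shows that I is multiplicative
-- on lists with no edges between them.  In G_v ∧ H_w, deleting the root leaves the disjoint union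
-- (G - v) + (H - w) and deleting its closed neighbourhood leaves (G - N[v]) + (H - N[w]); so the last two
-- bracket entries are ac and bd, and the recurrence at the root gives I(G_v ∧ H_w;-1) = ac - bd.
module Submission where

open import Defs hiding (sym)
open import Data.Bool using (Bool; true; false; _∧_; not; if_then_else_; T?)
open import Data.Bool.Properties using (∧-assoc; ∧-idem; ∧-commutativeMonoid)
open import Data.Nat using (ℕ; zero; suc; _+_; _≤_; _≡ᵇ_; s≤s)
open import Data.Nat.Properties using (≤-refl; ≤-trans)
open import Data.Fin using (Fin; zero; suc; punchIn; _↑ˡ_; _↑ʳ_)
open import Data.Fin.Properties using (splitAt-↑ˡ; splitAt-↑ʳ)
open import Data.List using (List; []; _∷_; [_]; map; _++_; length; filterᵇ; allFin; lookup; upTo; tabulate)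
open import Data.List.Properties
  using ( map-∘; map-++; map-cong; length-map; map-tabulate; tabulate-lookup; length-tabulate
        ; map-applyUpTo; length-filter; filter-++)
open import Data.List.Relation.Unary.All as All using (All; []; _∷_; universal)
open import Data.List.Relation.Unary.All.Properties using (map⁺; filter⁺)
open import Data.Vec using (Vec; []; _∷_)
import Data.Vec as Vec
open import Data.Integer using (ℤ; +_; -_; _-_; _*_; _^_; -1ℤ)
import Data.Integer as ℤ
open import Data.Integer.Properties
  using (+-identityˡ; +-identityʳ; +-assoc; +-comm; *-identityˡ; -1*i≡-i; neg-distrib-+; +-commutativeSemigroup)
open import Data.Integer.Tactic.RingSolver using (solve-∀)
open import Algebra.Bundles using (CommutativeMonoid)
open import Algebra.Properties.CommutativeSemigroup (CommutativeMonoid.commutativeSemigroup ∧-commutativeMonoid)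
  using () renaming (interchange to ∧-interchange)
open import Algebra.Properties.CommutativeSemigroup +-commutativeSemigroup
  using () renaming (interchange to +-interchange)
open import Data.Product using (_×_; _,_)
open import Function using (_∘_; id)
open import Relation.Binary.PropositionalEquality
  using (_≡_; refl; sym; trans; cong; cong₂; subst₂; module ≡-Reasoning)

private variable
  A B : Set

filterᵇ-map : (p : B → Bool) (f : A → B) (xs : List A) →
              filterᵇ p (map f xs) ≡ map f (filterᵇ (p ∘ f) xs)
filterᵇ-map p f []       = refl
filterᵇ-map p f (x ∷ xs) with p (f x)
... | true  = cong (f x ∷_) (filterᵇ-map p f xs)
... | false = filterᵇ-map p f xs

filterᵇ-∧ : (p q : A → Bool) (xs : List A) →
            filterᵇ (λ x → p x ∧ q x) xs ≡ filterᵇ q (filterᵇ p xs)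
filterᵇ-∧ p q []       = refl
filterᵇ-∧ p q (x ∷ xs) with p x
... | false = filterᵇ-∧ p q xs
... | true with q x
...   | true  = cong (x ∷_) (filterᵇ-∧ p q xs)
...   | false = filterᵇ-∧ p q xs

filterᵇ-all : {p : A → Bool} {xs : List A} → All (λ x → p x ≡ true) xs → filterᵇ p xs ≡ xs
filterᵇ-all []                     = refl
filterᵇ-all {xs = x ∷ _} (px ∷ pxs) rewrite px = cong (x ∷_) (filterᵇ-all pxs)

allFin-suc : ∀ n → allFin (suc n) ≡ zero ∷ map suc (allFin n)
allFin-suc n = cong (zero ∷_) (sym (map-tabulate id suc))

map-lookup-allFin : (xs : List A) → map (lookup xs) (allFin (length xs)) ≡ xs
map-lookup-allFin xs = trans (map-tabulate id (lookup xs)) (tabulate-lookup xs)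

map-allFin-+ : ∀ m k (g : Fin (m + k) → A) →
               map g (allFin (m + k)) ≡ map (g ∘ (_↑ˡ k)) (allFin m) ++ map (g ∘ (m ↑ʳ_)) (allFin k)
map-allFin-+ zero    k g = refl
map-allFin-+ (suc m) k g = begin
  map g (allFin (suc m + k))
    ≡⟨ cong (map g) (allFin-suc (m + k)) ⟩
  g zero ∷ map g (map suc (allFin (m + k)))
    ≡⟨ cong (g zero ∷_) (sym (map-∘ (allFin (m + k)))) ⟩
  g zero ∷ map (g ∘ suc) (allFin (m + k))
    ≡⟨ cong (g zero ∷_) (map-allFin-+ m k (g ∘ suc)) ⟩
  g zero ∷ map (g ∘ suc ∘ (_↑ˡ k)) (allFin m) ++ rest
    ≡⟨ cong (λ xs → g zero ∷ xs ++ rest) (map-∘ (allFin m)) ⟩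
  g zero ∷ map (g ∘ (_↑ˡ k)) (map suc (allFin m)) ++ rest
    ≡⟨ cong (λ xs → map (g ∘ (_↑ˡ k)) xs ++ rest) (sym (allFin-suc m)) ⟩
  map (g ∘ (_↑ˡ k)) (allFin (suc m)) ++ rest ∎
  where
  open ≡-Reasoning
  rest = map (g ∘ (suc m ↑ʳ_)) (allFin k)

allB-cong : {p q : A → Bool} → (∀ x → p x ≡ q x) → ∀ xs → allB p xs ≡ allB q xs
allB-cong p≗q []       = refl
allB-cong p≗q (x ∷ xs) = cong₂ _∧_ (p≗q x) (allB-cong p≗q xs)

allB-map : (p : B → Bool) (f : A → B) (xs : List A) → allB p (map f xs) ≡ allB (p ∘ f) xs
allB-map p f []       = refl
allB-map p f (x ∷ xs) = cong (p (f x) ∧_) (allB-map p f xs)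

allB-∧ : (p q : A → Bool) (xs : List A) → allB (λ x → p x ∧ q x) xs ≡ allB p xs ∧ allB q xs
allB-∧ p q []       = refl
allB-∧ p q (x ∷ xs) rewrite allB-∧ p q xs = ∧-interchange (p x) (q x) (allB p xs) (allB q xs)

allB-const-true : (xs : List A) → allB (λ _ → true) xs ≡ true
allB-const-true []       = refl
allB-const-true (x ∷ xs) = allB-const-true xs

allB-filterᵇ : (p q : A → Bool) (xs : List A) →
               allB (λ x → if p x then q x else true) xs ≡ allB q (filterᵇ p xs)
allB-filterᵇ p q []       = refl
allB-filterᵇ p q (x ∷ xs) with p x
... | true  = cong (q x ∧_) (allB-filterᵇ p q xs)
... | false = allB-filterᵇ p q xs

sumℤ-++ : (xs ys : List ℤ) → sumℤ (xs ++ ys) ≡ sumℤ xs ℤ.+ sumℤ ys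
sumℤ-++ []       ys = sym (+-identityˡ _)
sumℤ-++ (x ∷ xs) ys = trans (cong (λ t → x ℤ.+ t) (sumℤ-++ xs ys)) (sym (+-assoc x _ _))

sumℤ-zero : (f : A → ℤ) → (∀ x → f x ≡ + 0) → ∀ xs → sumℤ (map f xs) ≡ + 0
sumℤ-zero f f≡0 []       = refl
sumℤ-zero f f≡0 (x ∷ xs) rewrite f≡0 x | sumℤ-zero f f≡0 xs = refl

sumℤ-+ : (f g : A → ℤ) (xs : List A) →
         sumℤ (map (λ x → f x ℤ.+ g x) xs) ≡ sumℤ (map f xs) ℤ.+ sumℤ (map g xs)
sumℤ-+ f g []       = refl
sumℤ-+ f g (x ∷ xs) rewrite sumℤ-+ f g xs = +-interchange (f x) (g x) _ _

sumℤ-neg : (f : A → ℤ) (xs : List A) → sumℤ (map (λ x → - f x) xs) ≡ - sumℤ (map f xs)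
sumℤ-neg f []       = refl
sumℤ-neg f (x ∷ xs) rewrite sumℤ-neg f xs = sym (neg-distrib-+ (f x) _)

map-upTo-suc : (h : ℕ → A) (n : ℕ) → map h (upTo (suc n)) ≡ h 0 ∷ map (h ∘ suc) (upTo n)
map-upTo-suc h n = cong (h 0 ∷_) (trans (map-applyUpTo suc h n) (sym (map-applyUpTo id (h ∘ suc) n)))

sumℤ-indicator : ∀ s n (g : ℕ → ℤ) → s ≤ n →
                 sumℤ (map (λ j → if s ≡ᵇ j then g j else + 0) (upTo (suc n))) ≡ g s
sumℤ-indicator zero n g _ =
  trans (cong sumℤ (map-upTo-suc (λ j → if 0 ≡ᵇ j then g j else + 0) n))
        (trans (cong (λ t → g 0 ℤ.+ t) (sumℤ-zero _ (λ _ → refl) (upTo n))) (+-identityʳ _))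
sumℤ-indicator (suc s) (suc n) g (s≤s s≤n) =
  trans (cong sumℤ (map-upTo-suc (λ j → if suc s ≡ᵇ j then g j else + 0) (suc n)))
        (trans (+-identityˡ _) (sumℤ-indicator s n (g ∘ suc) s≤n))

sumℤ-count-by-size : {A : Set} (P : A → Bool) (sz : A → ℕ) (n : ℕ) (x : ℤ) →
                     (∀ S → sz S ≤ n) → (Ss : List A) →
  sumℤ (map (λ j → + length (filterᵇ (λ S → P S ∧ (sz S ≡ᵇ j)) Ss) * x ^ j) (upTo (suc n)))
    ≡ sumℤ (map (λ S → if P S then x ^ sz S else + 0) Ss)
sumℤ-count-by-size P sz n x sz≤n [] = sumℤ-zero _ (λ _ → refl) (upTo (suc n))
sumℤ-count-by-size {A} P sz n x sz≤n (S ∷ Ss) = begin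
  sumℤ (map (λ j → count (S ∷ Ss) j * x ^ j) (upTo (suc n)))
    ≡⟨ cong sumℤ (map-cong count-∷ (upTo (suc n))) ⟩
  sumℤ (map (λ j → term j ℤ.+ count Ss j * x ^ j) (upTo (suc n)))
    ≡⟨ sumℤ-+ term (λ j → count Ss j * x ^ j) (upTo (suc n)) ⟩
  sumℤ (map term (upTo (suc n))) ℤ.+ sumℤ (map (λ j → count Ss j * x ^ j) (upTo (suc n)))
    ≡⟨ cong₂ ℤ._+_ (sum-term (P S)) (sumℤ-count-by-size P sz n x sz≤n Ss) ⟩
  (if P S then x ^ sz S else + 0) ℤ.+ sumℤ (map (λ S → if P S then x ^ sz S else + 0) Ss) ∎
  where
  open ≡-Reasoning
  count : List A → ℕ → ℤ
  count Ts j = + length (filterᵇ (λ S → P S ∧ (sz S ≡ᵇ j)) Ts)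
  term : ℕ → ℤ
  term j = if P S ∧ (sz S ≡ᵇ j) then x ^ j else + 0
  count-∷ : ∀ j → count (S ∷ Ss) j * x ^ j ≡ term j ℤ.+ count Ss j * x ^ j
  count-∷ j with P S ∧ (sz S ≡ᵇ j)
  ... | true  = distrib (count Ss j) (x ^ j)
    where
    distrib : ∀ c y → (+ 1 ℤ.+ c) * y ≡ y ℤ.+ c * y
    distrib = solve-∀
  ... | false = sym (+-identityˡ _)
  sum-term : ∀ b → sumℤ (map (λ j → if b ∧ (sz S ≡ᵇ j) then x ^ j else + 0) (upTo (suc n)))
                   ≡ (if b then x ^ sz S else + 0)
  sum-term true  = sumℤ-indicator (sz S) n (x ^_) (sz≤n S)
  sum-term false = sumℤ-zero _ (λ _ → refl) (upTo (suc n))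

sublists : List A → List (List A)
sublists []       = [ [] ]
sublists (x ∷ xs) = map (x ∷_) (sublists xs) ++ sublists xs

isIndependentList : (A → A → Bool) → List A → Bool
isIndependentList R T = allB (λ x → allB (λ y → not (R x y)) T) T

weight : (A → A → Bool) → List A → ℤ
weight R T = if isIndependentList R T then -1ℤ ^ length T else + 0

-- I(G[L];-1), where L lists the vertices of an induced subgraph and R is the adjacency of G
listI₋₁ : (A → A → Bool) → List A → ℤ
listI₋₁ R L = sumℤ (map (weight R) (sublists L))

sumℤ-sublists-∷ : (f : List A → ℤ) (x : A) (xs : List A) →
  sumℤ (map f (sublists (x ∷ xs))) ≡ sumℤ (map (f ∘ (x ∷_)) (sublists xs)) ℤ.+ sumℤ (map f (sublists xs))
sumℤ-sublists-∷ f x xs =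
  trans (cong sumℤ (map-++ f (map (x ∷_) S) S))
        (trans (sumℤ-++ (map f (map (x ∷_) S)) (map f S))
               (cong (λ t → sumℤ t ℤ.+ sumℤ (map f S)) (sym (map-∘ {g = f} {f = x ∷_} S))))
  where S = sublists xs

restrict : (A → Bool) → (List A → ℤ) → List A → ℤ
restrict p f T = if allB p T then f T else + 0

sumℤ-sublists-restrict : (p : A → Bool) (f : List A → ℤ) (xs : List A) →
  sumℤ (map (restrict p f) (sublists xs)) ≡ sumℤ (map f (sublists (filterᵇ p xs)))
sumℤ-sublists-restrict p f []       = refl
sumℤ-sublists-restrict p f (y ∷ xs) with p y in py
... | true  =
  trans (sumℤ-sublists-∷ (restrict p f) y xs)
        (trans (cong₂ ℤ._+_ with-y (sumℤ-sublists-restrict p f xs))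
               (sym (sumℤ-sublists-∷ f y (filterᵇ p xs))))
  where
  with-y : sumℤ (map (restrict p f ∘ (y ∷_)) (sublists xs))
           ≡ sumℤ (map (f ∘ (y ∷_)) (sublists (filterᵇ p xs)))
  with-y =
    trans (cong sumℤ (map-cong (λ T → cong (λ b → if b ∧ allB p T then f (y ∷ T) else + 0) py) (sublists xs)))
          (sumℤ-sublists-restrict p (f ∘ (y ∷_)) xs)
... | false =
  trans (sumℤ-sublists-∷ (restrict p f) y xs)
        (trans (cong₂ ℤ._+_ without-y (sumℤ-sublists-restrict p f xs)) (+-identityˡ _))
  where
  without-y : sumℤ (map (restrict p f ∘ (y ∷_)) (sublists xs)) ≡ + 0
  without-y = sumℤ-zero _ (λ T → cong (λ b → if b ∧ allB p T then f (y ∷ T) else + 0) py) (sublists xs)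

sublists-map : (f : A → B) (xs : List A) → sublists (map f xs) ≡ map (map f) (sublists xs)
sublists-map f []       = refl
sublists-map f (x ∷ xs) = begin
  map (f x ∷_) (sublists (map f xs)) ++ sublists (map f xs)
    ≡⟨ cong (λ Ts → map (f x ∷_) Ts ++ Ts) (sublists-map f xs) ⟩
  map (f x ∷_) (map (map f) S) ++ map (map f) S
    ≡⟨ cong (_++ map (map f) S) (trans (sym (map-∘ S)) (map-∘ S)) ⟩
  map (map f) (map (x ∷_) S) ++ map (map f) S
    ≡⟨ sym (map-++ (map f) (map (x ∷_) S) S) ⟩
  map (map f) (map (x ∷_) S ++ S) ∎
  where
  open ≡-Reasoning
  S = sublists xs

isIndependentList-map : (R : B → B → Bool) (f : A → B) (T : List A) →
  isIndependentList R (map f T) ≡ isIndependentList (λ x y → R (f x) (f y)) T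
isIndependentList-map R f T =
  trans (allB-map (λ x → allB (λ y → not (R x y)) (map f T)) f T)
        (allB-cong (λ x → allB-map (λ y → not (R (f x) y)) f T) T)

listI₋₁-map : (R : B → B → Bool) (f : A → B) (L : List A) →
              listI₋₁ R (map f L) ≡ listI₋₁ (λ x y → R (f x) (f y)) L
listI₋₁-map R f L = begin
  sumℤ (map (weight R) (sublists (map f L)))     ≡⟨ cong (sumℤ ∘ map (weight R)) (sublists-map f L) ⟩
  sumℤ (map (weight R) (map (map f) (sublists L))) ≡⟨ cong sumℤ (sym (map-∘ (sublists L))) ⟩
  sumℤ (map (weight R ∘ map f) (sublists L))     ≡⟨ cong sumℤ (map-cong weight-map (sublists L)) ⟩
  listI₋₁ (λ x y → R (f x) (f y)) L             ∎
  where
  open ≡-Reasoning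
  weight-map : ∀ T → weight R (map f T) ≡ weight (λ x y → R (f x) (f y)) T
  weight-map T rewrite isIndependentList-map R f T | length-map f T = refl

NoEdgesBetween : (A → A → Bool) → List A → List A → Set
NoEdgesBetween R xs ys = All (λ x → All (λ y → R x y ≡ false) ys) xs

module _ (R : A → A → Bool) (R-sym : ∀ x y → R x y ≡ R y x) (R-irrefl : ∀ x → R x x ≡ false) where

  isIndependentList-∷ : ∀ x T →
    isIndependentList R (x ∷ T) ≡ allB (not ∘ R x) T ∧ isIndependentList R T
  isIndependentList-∷ x T rewrite R-irrefl x = begin
    allB (not ∘ R x) T ∧ allB (λ y → not (R y x) ∧ allB (not ∘ R y) T) T
      ≡⟨ cong (allB (not ∘ R x) T ∧_) (allB-∧ (λ y → not (R y x)) (λ y → allB (not ∘ R y) T) T) ⟩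
    allB (not ∘ R x) T ∧ (allB (λ y → not (R y x)) T ∧ isIndependentList R T)
      ≡⟨ cong (λ b → allB (not ∘ R x) T ∧ (b ∧ isIndependentList R T))
              (allB-cong (λ y → cong not (R-sym y x)) T) ⟩
    allB (not ∘ R x) T ∧ (allB (not ∘ R x) T ∧ isIndependentList R T)
      ≡⟨ sym (∧-assoc (allB (not ∘ R x) T) _ _) ⟩
    (allB (not ∘ R x) T ∧ allB (not ∘ R x) T) ∧ isIndependentList R T
      ≡⟨ cong (_∧ isIndependentList R T) (∧-idem (allB (not ∘ R x) T)) ⟩
    allB (not ∘ R x) T ∧ isIndependentList R T ∎
    where open ≡-Reasoning

  weight-∷ : ∀ x T → weight R (x ∷ T) ≡ - restrict (not ∘ R x) (weight R) T
  weight-∷ x T rewrite isIndependentList-∷ x T with allB (not ∘ R x) T | isIndependentList R T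
  ... | true  | true  = -1*i≡-i (-1ℤ ^ length T)
  ... | true  | false = refl
  ... | false | _     = refl

  listI₋₁-∷ : ∀ x xs → listI₋₁ R (x ∷ xs) ≡ listI₋₁ R xs - listI₋₁ R (filterᵇ (not ∘ R x) xs)
  listI₋₁-∷ x xs = begin
    listI₋₁ R (x ∷ xs)
      ≡⟨ sumℤ-sublists-∷ (weight R) x xs ⟩
    sumℤ (map (weight R ∘ (x ∷_)) (sublists xs)) ℤ.+ listI₋₁ R xs
      ≡⟨ cong (ℤ._+ listI₋₁ R xs) (cong sumℤ (map-cong (weight-∷ x) (sublists xs))) ⟩
    sumℤ (map (λ T → - restrict (not ∘ R x) (weight R) T) (sublists xs)) ℤ.+ listI₋₁ R xs
      ≡⟨ cong (ℤ._+ listI₋₁ R xs) (sumℤ-neg (restrict (not ∘ R x) (weight R)) (sublists xs)) ⟩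
    - sumℤ (map (restrict (not ∘ R x) (weight R)) (sublists xs)) ℤ.+ listI₋₁ R xs
      ≡⟨ cong (λ t → - t ℤ.+ listI₋₁ R xs) (sumℤ-sublists-restrict (not ∘ R x) (weight R) xs) ⟩
    - listI₋₁ R (filterᵇ (not ∘ R x) xs) ℤ.+ listI₋₁ R xs
      ≡⟨ +-comm _ (listI₋₁ R xs) ⟩
    listI₋₁ R xs - listI₋₁ R (filterᵇ (not ∘ R x) xs) ∎
    where open ≡-Reasoning

  listI₋₁-++ : ∀ xs ys → NoEdgesBetween R xs ys → listI₋₁ R (xs ++ ys) ≡ listI₋₁ R xs * listI₋₁ R ys
  listI₋₁-++ xs ys = go (length xs) xs ys ≤-refl
    where
    -- the recursion calls itself on a filtered list, so it is measured by length
    go : ∀ n xs ys → length xs ≤ n → NoEdgesBetween R xs ys →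
         listI₋₁ R (xs ++ ys) ≡ listI₋₁ R xs * listI₋₁ R ys
    go n       []       ys _          _             = sym (*-identityˡ _)
    go (suc n) (x ∷ xs) ys (s≤s |xs|≤n) (x↮ys ∷ xs↮ys) = begin
      listI₋₁ R (x ∷ xs ++ ys)
        ≡⟨ listI₋₁-∷ x (xs ++ ys) ⟩
      listI₋₁ R (xs ++ ys) - listI₋₁ R (filterᵇ (not ∘ R x) (xs ++ ys))
        ≡⟨ cong (λ zs → listI₋₁ R (xs ++ ys) - listI₋₁ R zs) filter-xs++ys ⟩
      listI₋₁ R (xs ++ ys) - listI₋₁ R (xs′ ++ ys)
        ≡⟨ cong₂ _-_ (go n xs ys |xs|≤n xs↮ys)
                     (go n xs′ ys (≤-trans (length-filter (T? ∘ not ∘ R x) xs) |xs|≤n)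
                        (filter⁺ (T? ∘ not ∘ R x) xs↮ys)) ⟩
      listI₋₁ R xs * listI₋₁ R ys - listI₋₁ R xs′ * listI₋₁ R ys
        ≡⟨ distribʳ (listI₋₁ R xs) (listI₋₁ R xs′) (listI₋₁ R ys) ⟩
      (listI₋₁ R xs - listI₋₁ R xs′) * listI₋₁ R ys
        ≡⟨ cong (_* listI₋₁ R ys) (sym (listI₋₁-∷ x xs)) ⟩
      listI₋₁ R (x ∷ xs) * listI₋₁ R ys ∎
      where
      open ≡-Reasoning
      xs′ = filterᵇ (not ∘ R x) xs
      filter-xs++ys : filterᵇ (not ∘ R x) (xs ++ ys) ≡ xs′ ++ ys
      filter-xs++ys = trans (filter-++ (T? ∘ not ∘ R x) xs ys)
                            (cong (xs′ ++_) (filterᵇ-all (All.map (cong not) x↮ys)))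
      distribʳ : ∀ a b c → a * c - b * c ≡ (a - b) * c
      distribʳ = solve-∀

support : ∀ {n} → Vec Bool n → List (Fin n)
support {n} S = filterᵇ (Vec.lookup S) (allFin n)

support-∷-tail : ∀ {n} b (S : Vec Bool n) → filterᵇ (Vec.lookup (b ∷ S)) (tabulate suc) ≡ map suc (support S)
support-∷-tail {n} b S = trans (cong (filterᵇ _) (sym (map-tabulate id suc))) (filterᵇ-map _ suc (allFin n))

support-∷ : ∀ {n} b (S : Vec Bool n) →
            support (b ∷ S) ≡ (if b then zero ∷ map suc (support S) else map suc (support S))
support-∷ true  S = cong (zero ∷_) (support-∷-tail true S)
support-∷ false S = support-∷-tail false S

map-support-allSubsets : ∀ n → map support (allSubsets n) ≡ sublists (allFin n)
map-support-allSubsets zero    = refl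
map-support-allSubsets (suc n) = begin
  map support (map (true ∷_) Ss ++ map (false ∷_) Ss)
    ≡⟨ map-++ support (map (true ∷_) Ss) (map (false ∷_) Ss) ⟩
  map support (map (true ∷_) Ss) ++ map support (map (false ∷_) Ss)
    ≡⟨ cong₂ _++_ (sym (map-∘ Ss)) (sym (map-∘ Ss)) ⟩
  map (support ∘ (true ∷_)) Ss ++ map (support ∘ (false ∷_)) Ss
    ≡⟨ cong₂ _++_ (map-cong (support-∷ true) Ss) (map-cong (support-∷ false) Ss) ⟩
  map ((zero ∷_) ∘ map suc ∘ support) Ss ++ map (map suc ∘ support) Ss
    ≡⟨ cong₂ _++_ (trans (map-∘ Ss) (cong (map (zero ∷_)) (map-∘ Ss))) (map-∘ Ss) ⟩
  map (zero ∷_) (map (map suc) (map support Ss)) ++ map (map suc) (map support Ss)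
    ≡⟨ cong (λ Ts → map (zero ∷_) (map (map suc) Ts) ++ map (map suc) Ts) (map-support-allSubsets n) ⟩
  map (zero ∷_) (map (map suc) (sublists (allFin n))) ++ map (map suc) (sublists (allFin n))
    ≡⟨ cong (λ Ts → map (zero ∷_) Ts ++ Ts) (sym (sublists-map suc (allFin n))) ⟩
  sublists (zero ∷ map suc (allFin n))
    ≡⟨ cong sublists (sym (allFin-suc n)) ⟩
  sublists (allFin (suc n)) ∎
  where
  open ≡-Reasoning
  Ss = allSubsets n

size-support : ∀ {n} (S : Vec Bool n) → size S ≡ length (support S)
size-support []          = refl
size-support (true  ∷ S) =
  trans (cong suc (trans (size-support S) (sym (length-map suc (support S)))))
        (cong length (sym (support-∷ true S)))
size-support (false ∷ S) =
  trans (trans (size-support S) (sym (length-map suc (support S))))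
        (cong length (sym (support-∷ false S)))

size≤ : ∀ {n} (S : Vec Bool n) → size S ≤ n
size≤ {n} S =
  subst₂ _≤_ (sym (size-support S)) (length-tabulate id) (length-filter (T? ∘ Vec.lookup S) (allFin n))

isIndependent-support : ∀ {n} (G : Graph n) (S : Vec Bool n) →
                        isIndependent G S ≡ isIndependentList (adj G) (support S)
isIndependent-support {n} G S =
  trans (allB-cong row (allFin n))
        (allB-filterᵇ (Vec.lookup S) (λ i → allB (not ∘ adj G i) (support S)) (allFin n))
  where
  entry : ∀ i j → not (Vec.lookup S j ∧ adj G i j) ≡ (if Vec.lookup S j then not (adj G i j) else true)
  entry i j with Vec.lookup S j
  ... | true  = refl
  ... | false = refl
  row : ∀ i → allB (λ j → not (Vec.lookup S i ∧ Vec.lookup S j ∧ adj G i j)) (allFin n)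
              ≡ (if Vec.lookup S i then allB (not ∘ adj G i) (support S) else true)
  row i with Vec.lookup S i
  ... | true  = trans (allB-cong (entry i) (allFin n)) (allB-filterᵇ (Vec.lookup S) (not ∘ adj G i) (allFin n))
  ... | false = allB-const-true (allFin n)

I₋₁≡listI₋₁ : ∀ {n} (G : Graph n) → I₋₁ G ≡ listI₋₁ (adj G) (allFin n)
I₋₁≡listI₋₁ {n} G = begin
  I₋₁ G
    ≡⟨ sumℤ-count-by-size (isIndependent G) size n -1ℤ size≤ (allSubsets n) ⟩
  sumℤ (map (λ S → if isIndependent G S then -1ℤ ^ size S else + 0) (allSubsets n))
    ≡⟨ cong sumℤ (map-cong term (allSubsets n)) ⟩
  sumℤ (map (weight (adj G) ∘ support) (allSubsets n))
    ≡⟨ cong sumℤ (map-∘ (allSubsets n)) ⟩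
  sumℤ (map (weight (adj G)) (map support (allSubsets n)))
    ≡⟨ cong (sumℤ ∘ map (weight (adj G))) (map-support-allSubsets n) ⟩
  listI₋₁ (adj G) (allFin n) ∎
  where
  open ≡-Reasoning
  term : ∀ S → (if isIndependent G S then -1ℤ ^ size S else + 0) ≡ weight (adj G) (support S)
  term S rewrite isIndependent-support G S | size-support S = refl

I₋₁-induced : ∀ {n} (G : Graph n) (p : Fin n → Bool) → I₋₁ (induced G p) ≡ listI₋₁ (adj G) (keep p)
I₋₁-induced G p =
  trans (I₋₁≡listI₋₁ (induced G p))
        (trans (sym (listI₋₁-map (adj G) (lookup (keep p)) (allFin (length (keep p)))))
               (cong (listI₋₁ (adj G)) (map-lookup-allFin (keep p))))

adjWithout : ∀ {m} → Graph (suc m) → Fin (suc m) → Fin m → Fin m → Bool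
adjWithout G v i j = adj G (punchIn v i) (punchIn v j)

keep-minusV : ∀ {m} (v : Fin (suc m)) → keep (minusV v) ≡ map (punchIn v) (allFin m)
keep-minusV {m} zero =
  trans (cong (filterᵇ (minusV zero)) (sym (map-tabulate id suc)))
        (filterᵇ-all (map⁺ (universal (λ _ → refl) (allFin m))))
keep-minusV {suc m} (suc v) = cong (zero ∷_) (begin
  filterᵇ (minusV (suc v)) (tabulate suc)             ≡⟨ cong (filterᵇ (minusV (suc v))) (sym (map-tabulate id suc)) ⟩
  filterᵇ (minusV (suc v)) (map suc (allFin (suc m))) ≡⟨ filterᵇ-map (minusV (suc v)) suc (allFin (suc m)) ⟩
  map suc (keep (minusV v))                           ≡⟨ cong (map suc) (keep-minusV v) ⟩
  map suc (map (punchIn v) (allFin m))                ≡⟨ sym (map-∘ (allFin m)) ⟩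
  map (punchIn (suc v) ∘ suc) (allFin m)              ≡⟨ map-∘ (allFin m) ⟩
  map (punchIn (suc v)) (map suc (allFin m))          ≡⟨ cong (map (punchIn (suc v))) (map-tabulate id suc) ⟩
  map (punchIn (suc v)) (tabulate suc)                ∎)
  where open ≡-Reasoning

keep-minusN : ∀ {m} (G : Graph (suc m)) (v : Fin (suc m)) →
              keep (minusN G v) ≡ map (punchIn v) (filterᵇ (not ∘ adj G v ∘ punchIn v) (allFin m))
keep-minusN {m} G v =
  trans (filterᵇ-∧ (minusV v) (not ∘ adj G v) (allFin (suc m)))
        (trans (cong (filterᵇ (not ∘ adj G v)) (keep-minusV v))
               (filterᵇ-map (not ∘ adj G v) (punchIn v) (allFin m)))

I₋₁-deleteVertex : ∀ {m} (G : Graph (suc m)) (v : Fin (suc m)) →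
                   I₋₁ (deleteVertex G v) ≡ listI₋₁ (adjWithout G v) (allFin m)
I₋₁-deleteVertex {m} G v =
  trans (I₋₁-induced G (minusV v))
        (trans (cong (listI₋₁ (adj G)) (keep-minusV v)) (listI₋₁-map (adj G) (punchIn v) (allFin m)))

I₋₁-deleteClosedNbhd : ∀ {m} (G : Graph (suc m)) (v : Fin (suc m)) →
  I₋₁ (deleteClosedNbhd G v) ≡ listI₋₁ (adjWithout G v) (filterᵇ (not ∘ adj G v ∘ punchIn v) (allFin m))
I₋₁-deleteClosedNbhd {m} G v =
  trans (I₋₁-induced G (minusN G v))
        (trans (cong (listI₋₁ (adj G)) (keep-minusN G v))
               (listI₋₁-map (adj G) (punchIn v) (filterᵇ (not ∘ adj G v ∘ punchIn v) (allFin m))))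

I₋₁-recurrence : ∀ {n} (G : Graph (suc n)) →
                 I₋₁ G ≡ I₋₁ (deleteVertex G zero) - I₋₁ (deleteClosedNbhd G zero)
I₋₁-recurrence {n} G = begin
  I₋₁ G
    ≡⟨ trans (I₋₁≡listI₋₁ G) (cong (listI₋₁ (adj G)) (allFin-suc n)) ⟩
  listI₋₁ (adj G) (zero ∷ map suc (allFin n))
    ≡⟨ listI₋₁-∷ (adj G) (Graph.sym G) (irrefl G) zero (map suc (allFin n)) ⟩
  listI₋₁ (adj G) (map suc (allFin n)) - listI₋₁ (adj G) (filterᵇ (not ∘ adj G zero) (map suc (allFin n)))
    ≡⟨ cong (λ L → listI₋₁ (adj G) (map suc (allFin n)) - listI₋₁ (adj G) L)
            (filterᵇ-map (not ∘ adj G zero) suc (allFin n)) ⟩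
  listI₋₁ (adj G) (map suc (allFin n)) - listI₋₁ (adj G) (map suc (filterᵇ (not ∘ adj G zero ∘ suc) (allFin n)))
    ≡⟨ cong₂ _-_ (listI₋₁-map (adj G) suc (allFin n))
                 (listI₋₁-map (adj G) suc (filterᵇ (not ∘ adj G zero ∘ suc) (allFin n))) ⟩
  listI₋₁ (adjWithout G zero) (allFin n) - listI₋₁ (adjWithout G zero) (filterᵇ (not ∘ adj G zero ∘ suc) (allFin n))
    ≡⟨ sym (cong₂ _-_ (I₋₁-deleteVertex G zero) (I₋₁-deleteClosedNbhd G zero)) ⟩
  I₋₁ (deleteVertex G zero) - I₋₁ (deleteClosedNbhd G zero) ∎
  where open ≡-Reasoning

module _ {m k : ℕ} (G : Graph (suc m)) (v : Fin (suc m)) (H : Graph (suc k)) (w : Fin (suc k)) where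

  private
    R : PV m k → PV m k → Bool
    R = adjPV G v H w

    P : Graph (suc (m + k))
    P = paste G v H w

    nonRoot : List (PV m k)
    nonRoot = map pG (allFin m) ++ map pH (allFin k)

  map-classify-suc : map (classify ∘ suc) (allFin (m + k)) ≡ nonRoot
  map-classify-suc =
    trans (map-allFin-+ m k (classify ∘ suc))
          (cong₂ _++_ (map-cong classify-↑ˡ (allFin m)) (map-cong classify-↑ʳ (allFin k)))
    where
    classify-↑ˡ : ∀ i → classify {m} {k} (suc (i ↑ˡ k)) ≡ pG i
    classify-↑ˡ i rewrite splitAt-↑ˡ m i k = refl
    classify-↑ʳ : ∀ i → classify {m} {k} (suc (m ↑ʳ i)) ≡ pH i
    classify-↑ʳ i rewrite splitAt-↑ʳ m k i = refl

  listI₋₁-pG++pH : ∀ is js →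
    listI₋₁ R (map pG is ++ map pH js) ≡ listI₋₁ (adjWithout G v) is * listI₋₁ (adjWithout H w) js
  listI₋₁-pG++pH is js =
    trans (listI₋₁-++ R (adjPV-sym G v H w) (adjPV-irrefl G v H w) (map pG is) (map pH js) no-edges)
          (cong₂ _*_ (listI₋₁-map R pG is) (listI₋₁-map R pH js))
    where
    no-edges : NoEdgesBetween R (map pG is) (map pH js)
    no-edges = map⁺ (universal (λ _ → map⁺ (universal (λ _ → refl) js)) is)

  I₋₁-paste-deleteVertex :
    I₋₁ (deleteVertex P (pasteRoot {m} {k})) ≡ I₋₁ (deleteVertex G v) * I₋₁ (deleteVertex H w)
  I₋₁-paste-deleteVertex = begin
    I₋₁ (deleteVertex P zero)                        ≡⟨ I₋₁-deleteVertex P zero ⟩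
    listI₋₁ (adjWithout P zero) (allFin (m + k))     ≡⟨ sym (listI₋₁-map R (classify ∘ suc) (allFin (m + k))) ⟩
    listI₋₁ R (map (classify ∘ suc) (allFin (m + k))) ≡⟨ cong (listI₋₁ R) map-classify-suc ⟩
    listI₋₁ R nonRoot                                ≡⟨ listI₋₁-pG++pH (allFin m) (allFin k) ⟩
    listI₋₁ (adjWithout G v) (allFin m) * listI₋₁ (adjWithout H w) (allFin k)
      ≡⟨ sym (cong₂ _*_ (I₋₁-deleteVertex G v) (I₋₁-deleteVertex H w)) ⟩
    I₋₁ (deleteVertex G v) * I₋₁ (deleteVertex H w)  ∎
    where open ≡-Reasoning

  I₋₁-paste-deleteClosedNbhd :
    I₋₁ (deleteClosedNbhd P (pasteRoot {m} {k})) ≡ I₋₁ (deleteClosedNbhd G v) * I₋₁ (deleteClosedNbhd H w)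
  I₋₁-paste-deleteClosedNbhd = begin
    I₋₁ (deleteClosedNbhd P zero)
      ≡⟨ I₋₁-deleteClosedNbhd P zero ⟩
    listI₋₁ (adjWithout P zero) (filterᵇ (q ∘ classify ∘ suc) (allFin (m + k)))
      ≡⟨ sym (listI₋₁-map R (classify ∘ suc) (filterᵇ (q ∘ classify ∘ suc) (allFin (m + k)))) ⟩
    listI₋₁ R (map (classify ∘ suc) (filterᵇ (q ∘ classify ∘ suc) (allFin (m + k))))
      ≡⟨ cong (listI₋₁ R) (sym (filterᵇ-map q (classify ∘ suc) (allFin (m + k)))) ⟩
    listI₋₁ R (filterᵇ q (map (classify ∘ suc) (allFin (m + k))))
      ≡⟨ cong (listI₋₁ R ∘ filterᵇ q) map-classify-suc ⟩
    listI₋₁ R (filterᵇ q nonRoot)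
      ≡⟨ cong (listI₋₁ R) filter-nonRoot ⟩
    listI₋₁ R (map pG (filterᵇ (q ∘ pG) (allFin m)) ++ map pH (filterᵇ (q ∘ pH) (allFin k)))
      ≡⟨ listI₋₁-pG++pH (filterᵇ (q ∘ pG) (allFin m)) (filterᵇ (q ∘ pH) (allFin k)) ⟩
    listI₋₁ (adjWithout G v) (filterᵇ (q ∘ pG) (allFin m)) * listI₋₁ (adjWithout H w) (filterᵇ (q ∘ pH) (allFin k))
      ≡⟨ sym (cong₂ _*_ (I₋₁-deleteClosedNbhd G v) (I₋₁-deleteClosedNbhd H w)) ⟩
    I₋₁ (deleteClosedNbhd G v) * I₋₁ (deleteClosedNbhd H w) ∎
    where
    open ≡-Reasoning
    q : PV m k → Bool
    q = not ∘ R pRoot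
    filter-nonRoot : filterᵇ q nonRoot
                     ≡ map pG (filterᵇ (q ∘ pG) (allFin m)) ++ map pH (filterᵇ (q ∘ pH) (allFin k))
    filter-nonRoot = trans (filter-++ (T? ∘ q) (map pG (allFin m)) (map pH (allFin k)))
                           (cong₂ _++_ (filterᵇ-map q pG (allFin m)) (filterᵇ-map q pH (allFin k)))

lemma2p2 : ∀ {m k : ℕ} (G : Graph (suc m)) (v : Fin (suc m)) (H : Graph (suc k)) (w : Fin (suc k))
    (a b c d : ℤ) → 1 ≤ m → 1 ≤ k →
    HasBracket G v (a - b) a b → HasBracket H w (c - d) c d →
    I₋₁ (paste G v H w) ≡ a * c - b * d
    × HasBracket (paste G v H w) (pasteRoot {m} {k}) (a * c - b * d) (a * c) (b * d)
lemma2p2 {m} {k} G v H w a b c d _ _ (_ , G-v≡a , G-N[v]≡b) (_ , H-w≡c , H-N[w]≡d) =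
  I≡ac-bd , I≡ac-bd , root-deleted , closedNbhd-deleted
  where
  root-deleted : I₋₁ (deleteVertex (paste G v H w) (pasteRoot {m} {k})) ≡ a * c
  root-deleted = trans (I₋₁-paste-deleteVertex G v H w) (cong₂ _*_ G-v≡a H-w≡c)
  closedNbhd-deleted : I₋₁ (deleteClosedNbhd (paste G v H w) (pasteRoot {m} {k})) ≡ b * d
  closedNbhd-deleted = trans (I₋₁-paste-deleteClosedNbhd G v H w) (cong₂ _*_ G-N[v]≡b H-N[w]≡d)
  I≡ac-bd : I₋₁ (paste G v H w) ≡ a * c - b * d
  I≡ac-bd = trans (I₋₁-recurrence (paste G v H w)) (cong₂ _-_ root-deleted closedNbhd-deleted)
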